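{- Let $L/F$ be any field extension, let $S$ be a finite-dimensional $F$-subspace of $L$, and let $X,Y$ be finite-dimensional $F$-subspaces of $L$. Then $$\partial_S(X+Y)+\partial_S(X\cap Y)\le \partial_S(X)+\partial_S(Y).$$
   Context: All dimensions are over $F$. For $F$-subspaces $X,S$ of $L$, $XS$ is the $F$-linear span of all products $xs$, $x\in X$, $s\in S$, and for finite-dimensional $X$, $\partial_S X=\dim(XS)-\dim(X)$. -}

module Defs where

open import Level using (Level; _⊔_)
open import Algebra.Bundles using (CommutativeRing)
open import Data.Nat using (ℕ; zero; suc)
open import Data.Fin using (Fin)
import Data.Fin as Fin
open import Data.Product using (Σ; ∃; _×_; _,_)
open import Relation.Nullary using (¬_)
open import Relation.Unary using (Pred)

record Field (c ℓ : Level) : Set (Level.suc (c ⊔ ℓ)) where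
  field
    commutativeRing : CommutativeRing c ℓ
  open CommutativeRing commutativeRing public
  field
    1≉0     : ¬ (1# ≈ 0#)
    inverse : ∀ x → ¬ (x ≈ 0#) → Σ Carrier (λ y → (x * y) ≈ 1#)

module _ {c ℓ : Level} (L : Field c ℓ) where
  open Field L using (Carrier; _≈_; _+_; _*_; -_; 0#; 1#)

  ∑ : (n : ℕ) → (Fin n → Carrier) → Carrier
  ∑ zero    f = 0#
  ∑ (suc n) f = f Fin.zero + ∑ n (λ i → f (Fin.suc i))

  -- F ⊆ L a subfield, given as a predicate on L (so L/F is a field extension)
  record IsSubfield {p : Level} (F : Pred Carrier p) : Set (c ⊔ ℓ ⊔ p) where
    field
      resp  : ∀ {x y} → x ≈ y → F x → F y
      zero∈ : F 0#
      one∈  : F 1#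
      +∈    : ∀ {x y} → F x → F y → F (x + y)
      -∈    : ∀ {x} → F x → F (- x)
      *∈    : ∀ {x y} → F x → F y → F (x * y)
      inv∈  : ∀ {x y} → F x → ¬ (x ≈ 0#) → (x * y) ≈ 1# → F y

  module _ {p : Level} (F : Pred Carrier p) where

    record IsSubspace {q : Level} (X : Pred Carrier q) : Set (c ⊔ ℓ ⊔ p ⊔ q) where
      field
        resp  : ∀ {x y} → x ≈ y → X x → X y
        zero∈ : X 0#
        +∈    : ∀ {x y} → X x → X y → X (x + y)
        scal∈ : ∀ {a x} → F a → X x → X (a * x)

    LinComb : (n : ℕ) → (Fin n → Carrier) → Carrier → Set (c ⊔ ℓ ⊔ p)
    LinComb n v z = Σ (Fin n → Carrier) (λ a → ((i : Fin n) → F (a i)) × (z ≈ ∑ n (λ i → a i * v i)))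

    LinIndep : (n : ℕ) → (Fin n → Carrier) → Set (c ⊔ ℓ ⊔ p)
    LinIndep n v = (a : Fin n → Carrier) → ((i : Fin n) → F (a i)) →
                   ∑ n (λ i → a i * v i) ≈ 0# → (i : Fin n) → a i ≈ 0#

    HasDim : {q : Level} → Pred Carrier q → ℕ → Set (c ⊔ ℓ ⊔ p ⊔ q)
    HasDim X n = Σ (Fin n → Carrier) (λ v →
                   ((i : Fin n) → X (v i)) × LinIndep n v ×
                   (∀ {x} → X x → LinComb n v x))

    -- XS : the F-linear span of all products x s, x ∈ X, s ∈ S
    ProdSpan : {q r : Level} → Pred Carrier q → Pred Carrier r → Pred Carrier (c ⊔ ℓ ⊔ p ⊔ q ⊔ r)
    ProdSpan X S z = ∃ λ (n : ℕ) → Σ (Fin n → Carrier) (λ x → Σ (Fin n → Carrier) (λ s →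
                       ((i : Fin n) → X (x i)) × ((i : Fin n) → S (s i)) ×
                       LinComb n (λ i → x i * s i) z))

  SumSp : {q r : Level} → Pred Carrier q → Pred Carrier r → Pred Carrier (c ⊔ ℓ ⊔ q ⊔ r)
  SumSp X Y z = Σ Carrier (λ x → Σ Carrier (λ y → X x × Y y × (z ≈ x + y)))

  IntSp : {q r : Level} → Pred Carrier q → Pred Carrier r → Pred Carrier (q ⊔ r)
  IntSp X Y z = X z × Y z

-- Extend a basis c of a space C lying in A ∩ B by families t ⊆ A and s ⊆ B to independent
-- families t ++ c and s ++ c spanning A and B. Then s ++ t ++ c spans A + B, and it is
-- independent when C = A ∩ B, so Steinitz exchange compares all dimensions with the
-- lengths of s, t, c. For X, Y this gives dim X + dim Y ≤ dim (X + Y) + dim (X ∩ Y); for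
-- XS, YS, using (X ∩ Y)S ⊆ XS ∩ YS and (X + Y)S ⊆ XS + YS, it gives
-- dim (X + Y)S + dim (X ∩ Y)S ≤ dim XS + dim YS, and the two combine to the claim.
-- Equality in L is not decidable, so the extension is built in the double-negation monad;
-- this costs nothing because the goal is a decidable inequality of integers.
module Submission where

open import Defs
open import Level using (Level; _⊔_)
open import Data.Nat as ℕ using (ℕ; zero; suc; z≤n; s≤s)
open import Data.Fin using (Fin; zero; suc; _↑ˡ_; _↑ʳ_; splitAt; join; punchIn)
open import Data.Nat.Properties using (m≤n⇒m≤1+n; +-monoˡ-≤; +-mono-≤; module ≤-Reasoning)
open import Data.Fin.Properties using (join-splitAt)
open import Data.Product using (∃; _×_; _,_; proj₁; proj₂)
open import Data.Sum using ([_,_])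
open import Data.Sum.Properties using ([,]-map)
open import Data.Vec.Functional using (Vector; _∷_; _++_; head; tail; insertAt)
open import Data.Vec.Functional.Properties using (lookup-++ˡ; lookup-++ʳ; insertAt-lookup; insertAt-punchIn)
open import Data.Vec.Functional.Relation.Unary.All using (All)
open import Data.Vec.Functional.Relation.Unary.All.Properties using (++⁺)
open import Function using (_∘_)
open import Relation.Binary.PropositionalEquality as ≡ using (_≡_; _≗_)
open import Relation.Nullary using (¬_; Dec; yes; no)
open import Relation.Nullary.Negation using (¬¬-map; negated-stable; ¬∃⟶∀¬)
open import Relation.Nullary.Decidable using (¬¬-excluded-middle; decidable-stable)
open import Relation.Unary using (Pred; _⊆_)
import Data.Nat.Tactic.RingSolver as ℕ-Solver
import Data.Integer.Properties as ℤ
import Data.Integer.Tactic.RingSolver as ℤ-Solver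

private
  variable
    q q′ r r′ : Level
    A : Set q
    B : Set r
    m n : ℕ

infixl 1 _>>=_

_>>=_ : ¬ ¬ A → (A → ¬ ¬ B) → ¬ ¬ B
¬¬x >>= f = negated-stable (¬¬-map f ¬¬x)

return : A → ¬ ¬ A
return x ¬x = ¬x x

¬¬-∀-Fin : {P : Fin n → Set q} → (∀ i → ¬ ¬ P i) → ¬ ¬ (∀ i → P i)
¬¬-∀-Fin {zero}  _ = return λ ()
¬¬-∀-Fin {suc n} h = do
  p₀ ← h zero
  ps ← ¬¬-∀-Fin (h ∘ suc)
  return λ { zero → p₀ ; (suc i) → ps i }

splitAt-elim : (P : Fin (m ℕ.+ n) → Set q) →
               (∀ i → P (i ↑ˡ n)) → (∀ j → P (m ↑ʳ j)) → ∀ l → P l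
splitAt-elim {m} {n} P hˡ hʳ l =
  ≡.subst P (join-splitAt m n l) ([_,_] {C = P ∘ join m n} hˡ hʳ (splitAt m l))

∷-++ : ∀ (x : A) (xs : Vector A m) (ys : Vector A n) → (x ∷ xs) ++ ys ≗ x ∷ (xs ++ ys)
∷-++ x xs ys zero    = ≡.refl
∷-++ {m = m} x xs ys (suc i) = [,]-map (splitAt m i)

insertAt⁺ : (P : Pred A q) {xs : Vector A n} {x : A} (k : Fin (suc n)) →
            P x → All P xs → All P (insertAt xs k x)
insertAt⁺             P zero    px pxs zero    = px
insertAt⁺             P zero    px pxs (suc j) = pxs j
insertAt⁺ {n = suc n} P (suc k) px pxs zero    = pxs zero
insertAt⁺ {n = suc n} P (suc k) px pxs (suc j) = insertAt⁺ P k px (pxs ∘ suc) j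

module _ {kA kB d dA dB dW : ℕ} where
  open ≤-Reasoning

  private
    regroup : ∀ x y z → (x ℕ.+ z) ℕ.+ (y ℕ.+ z) ≡ y ℕ.+ (x ℕ.+ z) ℕ.+ z
    regroup = ℕ-Solver.solve-∀

  inclusion-exclusion-≤ : kA ℕ.+ d ℕ.≤ dA → kB ℕ.+ d ℕ.≤ dB → dW ℕ.≤ kB ℕ.+ (kA ℕ.+ d) →
                          dW ℕ.+ d ℕ.≤ dA ℕ.+ dB
  inclusion-exclusion-≤ kA+d≤dA kB+d≤dB dW≤k = begin
    dW ℕ.+ d                             ≤⟨ +-monoˡ-≤ d dW≤k ⟩
    kB ℕ.+ (kA ℕ.+ d) ℕ.+ d              ≡⟨ regroup kA kB d ⟨
    (kA ℕ.+ d) ℕ.+ (kB ℕ.+ d)            ≤⟨ +-mono-≤ kA+d≤dA kB+d≤dB ⟩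
    dA ℕ.+ dB                            ∎

  inclusion-exclusion-≥ : dA ℕ.≤ kA ℕ.+ d → dB ℕ.≤ kB ℕ.+ d → kB ℕ.+ (kA ℕ.+ d) ℕ.≤ dW →
                          dA ℕ.+ dB ℕ.≤ dW ℕ.+ d
  inclusion-exclusion-≥ dA≤kA+d dB≤kB+d k≤dW = begin
    dA ℕ.+ dB                            ≤⟨ +-mono-≤ dA≤kA+d dB≤kB+d ⟩
    (kA ℕ.+ d) ℕ.+ (kB ℕ.+ d)            ≡⟨ regroup kA kB d ⟩
    kB ℕ.+ (kA ℕ.+ d) ℕ.+ d              ≤⟨ +-monoˡ-≤ d k≤dW ⟩
    dW ℕ.+ d                             ∎

module _ {c ℓ p : Level} (L : Field c ℓ) (F : Pred (Field.Carrier L) p) (isF : IsSubfield L F) where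
  open Field L hiding (zero)
  open IsSubfield isF hiding (resp) renaming
    (zero∈ to F-0; one∈ to F-1; +∈ to F-+; -∈ to F-neg; *∈ to F-*; inv∈ to F-inv)
  open import Algebra.Properties.Semiring.Sum semiring
    using (sum; sum-syntax; sum-cong-≋; sum-replicate-zero; sum-remove; ∑-distrib-+; *-distribˡ-sum; *-distribʳ-sum)
  open import Algebra.Properties.Ring ring using (+-inverseʳ-unique; -0#≈0#; -1*x≈-x; -‿distribˡ-*; -‿distribʳ-*)
  open import Algebra.Properties.CommutativeSemigroup +-commutativeSemigroup using (interchange)
  open import Relation.Binary.Reasoning.Setoid setoid

  private
    variable
      x y z : Carrier
      α β u v : Vector Carrier n

  F-inverse : F x → ¬ x ≈ 0# → ∃ λ y → F y × x * y ≈ 1#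
  F-inverse {x} x∈F x≉0 with inverse x x≉0
  ... | y , xy≈1 = y , F-inv x∈F x≉0 xy≈1 , xy≈1

  F-isSubspace : IsSubspace L F F
  F-isSubspace = record { resp = resp ; zero∈ = F-0 ; +∈ = F-+ ; scal∈ = F-* }
    where open IsSubfield isF using (resp)

  ∑≡sum : ∀ n (f : Vector Carrier n) → ∑ L n f ≡ sum f
  ∑≡sum zero    f = ≡.refl
  ∑≡sum (suc n) f = ≡.cong (f zero +_) (∑≡sum n (tail f))

  sum-↑ : ∀ m (f : Vector Carrier (m ℕ.+ n)) → sum f ≈ sum (f ∘ (_↑ˡ n)) + sum (f ∘ (m ↑ʳ_))
  sum-↑ zero    f = sym (+-identityˡ (sum f))
  sum-↑ (suc m) f = trans (+-congˡ (sum-↑ m (tail f))) (sym (+-assoc _ _ _))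

  infix 8 _·_

  _·_ : Vector Carrier n → Vector Carrier n → Carrier
  _·_ {n} a v = ∑[ i < n ] (a i * v i)

  ·-congˡ : (∀ i → α i ≈ β i) → α · v ≈ β · v
  ·-congˡ α≈β = sum-cong-≋ (λ i → *-congʳ (α≈β i))

  ·-congʳ : (∀ i → u i ≈ v i) → α · u ≈ α · v
  ·-congʳ u≈v = sum-cong-≋ (λ i → *-congˡ (u≈v i))

  ·-zeroˡ : (∀ i → α i ≈ 0#) → α · v ≈ 0#
  ·-zeroˡ {n} {v = v} α≈0 =
    trans (sum-cong-≋ (λ i → trans (*-congʳ (α≈0 i)) (zeroˡ (v i)))) (sum-replicate-zero n)

  ·-zeroʳ : (∀ i → v i ≈ 0#) → α · v ≈ 0#
  ·-zeroʳ {n} {α = α} v≈0 =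
    trans (sum-cong-≋ (λ i → trans (*-congˡ (v≈0 i)) (zeroʳ (α i)))) (sum-replicate-zero n)

  ·-distribˡ-+ : ∀ (α u v : Vector Carrier n) → α · (λ i → u i + v i) ≈ α · u + α · v
  ·-distribˡ-+ α u v =
    trans (sum-cong-≋ (λ i → distribˡ (α i) (u i) (v i))) (∑-distrib-+ (λ i → α i * u i) (λ i → α i * v i))

  ·-++ : ∀ (γ : Vector Carrier (m ℕ.+ n)) (u : Vector Carrier m) (v : Vector Carrier n) →
         γ · (u ++ v) ≈ (γ ∘ (_↑ˡ n)) · u + (γ ∘ (m ↑ʳ_)) · v
  ·-++ {m} γ u v = trans (sum-↑ m _)
    (+-cong (·-congʳ (reflexive ∘ lookup-++ˡ u v)) (·-congʳ (reflexive ∘ lookup-++ʳ u v)))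

  ·-∈ : ∀ {n} {α v : Vector Carrier n} {X : Pred Carrier q} →
        IsSubspace L F X → All F α → All X v → X (α · v)
  ·-∈ {n = zero}  X-sub _   _   = IsSubspace.zero∈ X-sub
  ·-∈ {n = suc n} X-sub α∈F v∈X =
    +∈ (scal∈ (α∈F zero) (v∈X zero)) (·-∈ X-sub (α∈F ∘ suc) (v∈X ∘ suc))
    where open IsSubspace X-sub

  neg-∈ : {X : Pred Carrier q} → IsSubspace L F X → X x → X (- x)
  neg-∈ X-sub x∈X = resp (-1*x≈-x _) (scal∈ (F-neg F-1) x∈X)
    where open IsSubspace X-sub

  -- LinComb restated with the library's sum, so that Algebra.Properties.Semiring.Sum applies.
  Span : Vector Carrier n → Pred Carrier (c ⊔ ℓ ⊔ p)
  Span v z = ∃ λ α → All F α × z ≈ α · v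

  LinComb⇒Span : LinComb L F n v z → Span v z
  LinComb⇒Span {n} (α , α∈F , z≈) = α , α∈F , trans z≈ (reflexive (∑≡sum n _))

  Span⇒LinComb : Span v z → LinComb L F n v z
  Span⇒LinComb {n} (α , α∈F , z≈) = α , α∈F , trans z≈ (reflexive (≡.sym (∑≡sum n _)))

  Span⊆ : {X : Pred Carrier q} → IsSubspace L F X → All X v → Span v ⊆ X
  Span⊆ X-sub v∈X (α , α∈F , z≈) = IsSubspace.resp X-sub (sym z≈) (·-∈ X-sub α∈F v∈X)

  Span-isSubspace : IsSubspace L F (Span v)
  Span-isSubspace {n} {v} = record
    { resp  = λ { x≈y (α , α∈F , x≈) → α , α∈F , trans (sym x≈y) x≈ }
    ; zero∈ = (λ _ → 0#) , (λ _ → F-0) , sym (·-zeroˡ {v = v} (λ _ → refl))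
    ; +∈    = +∈
    ; scal∈ = scal∈
    }
    where
    +∈ : Span v x → Span v y → Span v (x + y)
    +∈ {x} {y} (α , α∈F , x≈) (β , β∈F , y≈) =
      (λ i → α i + β i) , (λ i → F-+ (α∈F i) (β∈F i)) , (begin
      x + y                                  ≈⟨ +-cong x≈ y≈ ⟩
      α · v + β · v                          ≈⟨ ∑-distrib-+ (λ i → α i * v i) (λ i → β i * v i) ⟨
      ∑[ i < n ] (α i * v i + β i * v i)     ≈⟨ sum-cong-≋ (λ i → distribʳ (v i) (α i) (β i)) ⟨
      (λ i → α i + β i) · v                  ∎)
    scal∈ : ∀ {b} → F b → Span v x → Span v (b * x)
    scal∈ {x} {b} b∈F (α , α∈F , x≈) = (λ i → b * α i) , (λ i → F-* b∈F (α∈F i)) , (begin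
      b * x                            ≈⟨ *-congˡ x≈ ⟩
      b * (α · v)                      ≈⟨ *-distribˡ-sum b (λ i → α i * v i) ⟩
      ∑[ i < n ] (b * (α i * v i))     ≈⟨ sum-cong-≋ (λ i → *-assoc b (α i) (v i)) ⟨
      (λ i → b * α i) · v              ∎)

  Span-mono : {w : Vector Carrier m} → All (Span w) v → Span v ⊆ Span w
  Span-mono = Span⊆ Span-isSubspace

  ∈-Span : ∀ (v : Vector Carrier n) i → Span v (v i)
  ∈-Span {suc n} v zero = (1# ∷ λ _ → 0#) , (λ { zero → F-1 ; (suc _) → F-0 }) ,
    sym (trans (+-cong (*-identityˡ (v zero)) (·-zeroˡ {v = tail v} (λ _ → refl))) (+-identityʳ (v zero)))
  ∈-Span {suc n} v (suc i) with ∈-Span (tail v) i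
  ... | α , α∈F , vᵢ≈ = (0# ∷ α) , (λ { zero → F-0 ; (suc j) → α∈F j }) ,
    trans vᵢ≈ (sym (trans (+-congʳ (zeroˡ (v zero))) (+-identityˡ _)))

  Span-resp-≗ : u ≗ v → Span u ⊆ Span v
  Span-resp-≗ u≗v (α , α∈F , z≈) = α , α∈F , trans z≈ (·-congʳ (reflexive ∘ u≗v))

  Span-++ˡ : ∀ (u : Vector Carrier m) (v : Vector Carrier n) → Span u ⊆ Span (u ++ v)
  Span-++ˡ {n = n} u v = Span-mono (λ i → ≡.subst (Span (u ++ v)) (lookup-++ˡ u v i) (∈-Span (u ++ v) (i ↑ˡ n)))

  Span-++ʳ : ∀ (u : Vector Carrier m) (v : Vector Carrier n) → Span v ⊆ Span (u ++ v)
  Span-++ʳ {m} u v = Span-mono (λ j → ≡.subst (Span (u ++ v)) (lookup-++ʳ u v j) (∈-Span (u ++ v) (m ↑ʳ j)))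

  -- LinIndep up to double negation: without decidable equality in L this is what survives
  -- adjoining a vector outside the span.
  LinIndep¬¬ : Vector Carrier n → Set (c ⊔ ℓ ⊔ p)
  LinIndep¬¬ v = ∀ α → All F α → α · v ≈ 0# → ∀ i → ¬ ¬ α i ≈ 0#

  LinIndep⇒LinIndep¬¬ : LinIndep L F n v → LinIndep¬¬ v
  LinIndep⇒LinIndep¬¬ {n} indep α α∈F rel i = return (indep α α∈F (trans (reflexive (∑≡sum n _)) rel) i)

  LinIndep¬¬-resp-≗ : u ≗ v → LinIndep¬¬ u → LinIndep¬¬ v
  LinIndep¬¬-resp-≗ u≗v indep α α∈F rel = indep α α∈F (trans (·-congʳ (reflexive ∘ u≗v)) rel)

  LinIndep¬¬-∷ : ¬ Span v x → LinIndep¬¬ v → LinIndep¬¬ (x ∷ v)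
  LinIndep¬¬-∷ {v = v} {x} x∉ indep α α∈F rel = λ
    { zero    → α₀≈0
    ; (suc i) → α₀≈0 >>= λ α₀≈0 → indep (tail α) (α∈F ∘ suc) (tail-rel α₀≈0) i
    }
    where
    open IsSubspace (Span-isSubspace {v = v}) using (resp; scal∈)
    α₀≈0 : ¬ ¬ α zero ≈ 0#
    α₀≈0 α₀≉0 with F-inverse (α∈F zero) α₀≉0
    ... | d , d∈F , α₀d≈1 = x∉ (resp (sym x≈) (scal∈ (F-neg d∈F) (tail α , α∈F ∘ suc , refl)))
      where
      x≈ : x ≈ - d * (tail α · v)
      x≈ = begin
        x                       ≈⟨ *-identityˡ x ⟨
        1# * x                  ≈⟨ *-congʳ (trans (sym α₀d≈1) (*-comm _ _)) ⟩
        d * α zero * x          ≈⟨ *-assoc d _ x ⟩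
        d * (α zero * x)        ≈⟨ *-congˡ (+-inverseʳ-unique _ _ (trans (+-comm _ _) rel)) ⟩
        d * - (tail α · v)      ≈⟨ -‿distribʳ-* d _ ⟨
        - (d * (tail α · v))    ≈⟨ -‿distribˡ-* d _ ⟩
        - d * (tail α · v)      ∎
    tail-rel : α zero ≈ 0# → tail α · v ≈ 0#
    tail-rel α₀≈0 = begin
      tail α · v                    ≈⟨ +-identityˡ _ ⟨
      0# + tail α · v               ≈⟨ +-congʳ (trans (*-congʳ α₀≈0) (zeroˡ x)) ⟨
      α zero * x + tail α · v       ≈⟨ rel ⟩
      0#                            ∎

  LinIndep¬¬-eliminate : ∀ {u : Vector Carrier (suc n)} k (e : Vector Carrier n) → All F e →
    LinIndep¬¬ u → LinIndep¬¬ (λ i → u (punchIn k i) + e i * u k)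
  LinIndep¬¬-eliminate {n} {u} k e e∈F indep α α∈F rel i =
    ≡.subst (λ y → ¬ ¬ y ≈ 0#) (insertAt-punchIn α k s i) (indep α′ α′∈F rel′ (punchIn k i))
    where
    s : Carrier
    s = α · e
    α′ : Vector Carrier (suc n)
    α′ = insertAt α k s
    α′∈F : All F α′
    α′∈F = insertAt⁺ F k (·-∈ F-isSubspace α∈F e∈F) α∈F
    rel′ : α′ · u ≈ 0#
    rel′ = begin
      α′ · u                                                      ≈⟨ sum-remove {i = k} (λ l → α′ l * u l) ⟩
      α′ k * u k + ∑[ i < n ] (α′ (punchIn k i) * u (punchIn k i))
        ≈⟨ +-cong (*-congʳ (reflexive (insertAt-lookup α k s)))
                  (sum-cong-≋ (λ i → *-congʳ (reflexive (insertAt-punchIn α k s i)))) ⟩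
      s * u k + ∑[ i < n ] (α i * u (punchIn k i))                ≈⟨ +-comm _ _ ⟩
      ∑[ i < n ] (α i * u (punchIn k i)) + s * u k                ≈⟨ +-congˡ (*-distribʳ-sum (u k) (λ i → α i * e i)) ⟩
      ∑[ i < n ] (α i * u (punchIn k i)) + ∑[ i < n ] (α i * e i * u k)
        ≈⟨ ∑-distrib-+ (λ i → α i * u (punchIn k i)) (λ i → α i * e i * u k) ⟨
      ∑[ i < n ] (α i * u (punchIn k i) + α i * e i * u k)
        ≈⟨ sum-cong-≋ (λ i → trans (+-congˡ (*-assoc (α i) (e i) (u k))) (sym (distribˡ (α i) _ _))) ⟩
      α · (λ i → u (punchIn k i) + e i * u k)                     ≈⟨ rel ⟩
      0#                                                          ∎

  eliminate-pivot : ∀ {b b′ e x y y′} → e * b′ ≈ - b → (b * x + y) + e * (b′ * x + y′) ≈ y + e * y′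
  eliminate-pivot {b} {b′} {e} {x} {y} {y′} eb′≈-b = begin
    (b * x + y) + e * (b′ * x + y′)       ≈⟨ +-congˡ (trans (distribˡ e _ _) (+-congʳ (sym (*-assoc e b′ x)))) ⟩
    (b * x + y) + (e * b′ * x + e * y′)   ≈⟨ +-congˡ (+-congʳ (*-congʳ eb′≈-b)) ⟩
    (b * x + y) + (- b * x + e * y′)      ≈⟨ interchange _ _ _ _ ⟩
    (b * x + - b * x) + (y + e * y′)      ≈⟨ +-congʳ b*x-b*x≈0 ⟩
    0# + (y + e * y′)                     ≈⟨ +-identityˡ _ ⟩
    y + e * y′                            ∎
    where
    b*x-b*x≈0 : b * x + - b * x ≈ 0#
    b*x-b*x≈0 = trans (sym (distribʳ x b (- b))) (trans (*-congʳ (-‿inverseʳ b)) (zeroˡ x))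

  -- Expand every u i along head v: either all coefficients vanish and u lies in the span of
  -- tail v, or a pivot u k with invertible coefficient eliminates head v from the others.
  steinitz : ∀ {m n} (v : Vector Carrier m) (u : Vector Carrier n) →
             LinIndep¬¬ u → All (Span v) u → ¬ ¬ n ℕ.≤ m
  steinitz {_}     {zero}  _ _ _     _  = return z≤n
  steinitz {zero}  {suc n} _ u indep u∈ =
    λ _ → indep (λ _ → 1#) (λ _ → F-1) (·-zeroʳ {α = λ _ → 1#} (λ i → proj₂ (proj₂ (u∈ i)))) zero 1≉0
  steinitz {suc m} {suc n} v u indep u∈ = ¬¬-excluded-middle >>= pivot
    where
    b : Vector Carrier (suc n)
    b i = proj₁ (u∈ i) zero
    b∈F : All F b
    b∈F i = proj₁ (proj₂ (u∈ i)) zero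
    rest : Vector Carrier (suc n)
    rest i = tail (proj₁ (u∈ i)) · tail v
    rest∈ : All (Span (tail v)) rest
    rest∈ i = tail (proj₁ (u∈ i)) , proj₁ (proj₂ (u∈ i)) ∘ suc , refl
    u≈ : ∀ i → u i ≈ b i * head v + rest i
    u≈ i = proj₂ (proj₂ (u∈ i))
    open IsSubspace (Span-isSubspace {v = tail v}) using (resp; +∈; scal∈)

    pivot : Dec (∃ λ k → ¬ b k ≈ 0#) → ¬ ¬ suc n ℕ.≤ suc m
    pivot (no ∄k) = do
      b≈0 ← ¬¬-∀-Fin (¬∃⟶∀¬ ∄k)
      1+n≤m ← steinitz (tail v) u indep (λ i → resp (sym (u≈rest b≈0 i)) (rest∈ i))
      return (m≤n⇒m≤1+n 1+n≤m)
      where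
      u≈rest : (∀ i → b i ≈ 0#) → ∀ i → u i ≈ rest i
      u≈rest b≈0 i = trans (u≈ i) (trans (+-congʳ (trans (*-congʳ (b≈0 i)) (zeroˡ _))) (+-identityˡ _))
    pivot (yes (k , bₖ≉0)) with F-inverse (b∈F k) bₖ≉0
    ... | d , d∈F , bₖd≈1 = do
      n≤m ← steinitz (tail v) _ (LinIndep¬¬-eliminate {u = u} k e e∈F indep) u′∈
      return (s≤s n≤m)
      where
      e : Vector Carrier n
      e i = - (b (punchIn k i) * d)
      e∈F : All F e
      e∈F i = F-neg (F-* (b∈F (punchIn k i)) d∈F)
      ebₖ≈ : ∀ i → e i * b k ≈ - b (punchIn k i)
      ebₖ≈ i = trans (sym (-‿distribˡ-* _ (b k)))
        (-‿cong (trans (*-assoc _ d (b k)) (trans (*-congˡ (trans (*-comm d (b k)) bₖd≈1)) (*-identityʳ _))))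
      u′∈ : All (Span (tail v)) (λ i → u (punchIn k i) + e i * u k)
      u′∈ i = resp (sym (trans (+-cong (u≈ _) (*-congˡ (u≈ k))) (eliminate-pivot (ebₖ≈ i))))
                   (+∈ (rest∈ _) (scal∈ (e∈F i) (rest∈ k)))

  record Extension (Q : Pred Carrier q) (u : Vector Carrier n) (v : Vector Carrier m) : Set (c ⊔ ℓ ⊔ p ⊔ q) where
    field
      {size} : ℕ
      new    : Vector Carrier size
      new∈   : All Q new
      indep  : LinIndep¬¬ (new ++ u)
      spans  : All (Span (new ++ u)) v

  open Extension

  extend : {Q : Pred Carrier q} (u : Vector Carrier n) (v : Vector Carrier m) →
           LinIndep¬¬ u → All Q v → ¬ ¬ Extension Q u v
  extend {m = zero}  u v u-indep _   = return record { new = λ () ; new∈ = λ () ; indep = u-indep ; spans = λ () }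
  extend {n = n} {m = suc m} {Q = Q} u v u-indep v∈Q = do
    E ← extend u (tail v) u-indep (v∈Q ∘ suc)
    v₀∈? ← ¬¬-excluded-middle
    return (adjoin E v₀∈?)
    where
    adjoin : (E : Extension Q u (tail v)) → Dec (Span (new E ++ u) (head v)) → Extension Q u v
    adjoin E (yes v₀∈) = record
      { new = new E ; new∈ = new∈ E ; indep = indep E ; spans = λ { zero → v₀∈ ; (suc i) → spans E i } }
    adjoin E (no v₀∉) = record
      { new   = head v ∷ new E
      ; new∈  = λ { zero → v∈Q zero ; (suc j) → new∈ E j }
      ; indep = LinIndep¬¬-resp-≗ reassoc (LinIndep¬¬-∷ v₀∉ (indep E))
      ; spans = λ i → Span-resp-≗ reassoc (spans′ i)
      }
      where
      reassoc : head v ∷ (new E ++ u) ≗ (head v ∷ new E) ++ u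
      reassoc l = ≡.sym (∷-++ (head v) (new E) u l)
      w : Vector Carrier (suc (size E ℕ.+ n))
      w = head v ∷ (new E ++ u)
      spans′ : All (Span w) v
      spans′ zero    = ∈-Span w zero
      spans′ (suc i) = Span-mono {w = w} (∈-Span w ∘ suc) (spans E i)

  LinIndep¬¬-++⁻ : ∀ {m n} (u : Vector Carrier m) (v : Vector Carrier n) {α β} → LinIndep¬¬ (u ++ v) →
                   All F α → All F β → α · u + β · v ≈ 0# → ∀ i → ¬ ¬ α i ≈ 0#
  LinIndep¬¬-++⁻ {n = n} u v {α} {β} indep α∈F β∈F rel i =
    ≡.subst (λ y → ¬ ¬ y ≈ 0#) (lookup-++ˡ α β i) (indep (α ++ β) (++⁺ F α∈F β∈F) rel′ (i ↑ˡ n))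
    where
    rel′ : (α ++ β) · (u ++ v) ≈ 0#
    rel′ = trans (·-++ (α ++ β) u v)
      (trans (+-cong (·-congˡ (reflexive ∘ lookup-++ˡ α β)) (·-congˡ (reflexive ∘ lookup-++ʳ α β))) rel)

  LinIndep¬¬-++⁺ : ∀ {m n} {u : Vector Carrier m} {v : Vector Carrier n} →
    (∀ {α β} → All F α → All F β → α · u + β · v ≈ 0# →
               (∀ i → ¬ ¬ α i ≈ 0#) × (∀ j → ¬ ¬ β j ≈ 0#)) →
    LinIndep¬¬ (u ++ v)
  LinIndep¬¬-++⁺ {m} {n} {u} {v} split γ γ∈F rel =
    splitAt-elim (λ l → ¬ ¬ γ l ≈ 0#) (proj₁ parts) (proj₂ parts)
    where
    parts : (∀ i → ¬ ¬ γ (i ↑ˡ n) ≈ 0#) × (∀ j → ¬ ¬ γ (m ↑ʳ j) ≈ 0#)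
    parts = split (γ∈F ∘ (_↑ˡ n)) (γ∈F ∘ (m ↑ʳ_)) (trans (sym (·-++ γ u v)) rel)

  -- A relation α·s + β·t ≈ 0 puts β·t in A ∩ B, hence in the span of c, where s ++ c is independent.
  LinIndep¬¬-++-∩ : ∀ {k m n} {A : Pred Carrier q} {B : Pred Carrier r}
    {s : Vector Carrier m} {t : Vector Carrier n} (c : Vector Carrier k) →
    IsSubspace L F A → IsSubspace L F B → IntSp L A B ⊆ Span c → All B s → All A t →
    LinIndep¬¬ (s ++ c) → LinIndep¬¬ t → LinIndep¬¬ (s ++ t)
  LinIndep¬¬-++-∩ {s = s} {t} c A-sub B-sub A∩B⊆c s∈B t∈A sc-indep t-indep = LinIndep¬¬-++⁺ parts
    where
    parts : ∀ {α β} → All F α → All F β → α · s + β · t ≈ 0# →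
            (∀ i → ¬ ¬ α i ≈ 0#) × (∀ j → ¬ ¬ β j ≈ 0#)
    parts {α} {β} α∈F β∈F rel = α≈0 , β≈0
      where
      β·t≈-α·s : β · t ≈ - (α · s)
      β·t≈-α·s = +-inverseʳ-unique (α · s) (β · t) rel
      β·t∈c : Span c (β · t)
      β·t∈c = A∩B⊆c (·-∈ A-sub β∈F t∈A ,
                     IsSubspace.resp B-sub (sym β·t≈-α·s) (neg-∈ B-sub (·-∈ B-sub α∈F s∈B)))
      α≈0 : ∀ i → ¬ ¬ α i ≈ 0#
      α≈0 = LinIndep¬¬-++⁻ s c sc-indep α∈F (proj₁ (proj₂ β·t∈c))
                            (trans (+-congˡ (sym (proj₂ (proj₂ β·t∈c)))) rel)
      β≈0 : ∀ j → ¬ ¬ β j ≈ 0#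
      β≈0 j = do
        α≈0′ ← ¬¬-∀-Fin α≈0
        t-indep β β∈F (trans β·t≈-α·s (trans (-‿cong (·-zeroˡ α≈0′)) -0#≈0#)) j

  SumSp-mono : {A : Pred Carrier q} {A′ : Pred Carrier q′} {B : Pred Carrier r} {B′ : Pred Carrier r′} →
               A ⊆ A′ → B ⊆ B′ → SumSp L A B ⊆ SumSp L A′ B′
  SumSp-mono A⊆A′ B⊆B′ (x , y , x∈A , y∈B , z≈) = x , y , A⊆A′ x∈A , B⊆B′ y∈B , z≈

  SumSp-inl : {A : Pred Carrier q} {B : Pred Carrier r} → IsSubspace L F B → A ⊆ SumSp L A B
  SumSp-inl B-sub {x} x∈A = x , 0# , x∈A , IsSubspace.zero∈ B-sub , sym (+-identityʳ x)

  SumSp-inr : {A : Pred Carrier q} {B : Pred Carrier r} → IsSubspace L F A → B ⊆ SumSp L A B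
  SumSp-inr A-sub {y} y∈B = 0# , y , IsSubspace.zero∈ A-sub , y∈B , sym (+-identityˡ y)

  SumSp-Span-++ : ∀ {k m n} (s : Vector Carrier m) (t : Vector Carrier n) (c : Vector Carrier k) →
                  SumSp L (Span (t ++ c)) (Span (s ++ c)) ⊆ Span (s ++ (t ++ c))
  SumSp-Span-++ s t c (x , y , x∈ , y∈ , z≈) =
    resp (sym z≈) (+∈ (Span-++ʳ s (t ++ c) x∈) (Span-mono s++c∈ y∈))
    where
    open IsSubspace (Span-isSubspace {v = s ++ (t ++ c)}) using (resp; +∈)
    s++c∈ : All (Span (s ++ (t ++ c))) (s ++ c)
    s++c∈ = ++⁺ (Span (s ++ (t ++ c))) (Span-++ˡ s (t ++ c) ∘ ∈-Span s)
                                        (Span-++ʳ s (t ++ c) ∘ Span-++ʳ t c ∘ ∈-Span c)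

  dim-sum+dim-inter≤ : ∀ {dA dB dC dW} {A : Pred Carrier q} {B : Pred Carrier q′}
                       {C : Pred Carrier r} {W : Pred Carrier r′} →
    HasDim L F A dA → HasDim L F B dB → HasDim L F C dC → HasDim L F W dW →
    C ⊆ IntSp L A B → W ⊆ SumSp L A B → ¬ ¬ dW ℕ.+ dC ℕ.≤ dA ℕ.+ dB
  dim-sum+dim-inter≤ {A = A} {B} (a , a∈A , _ , A⊆a) (b , b∈B , _ , B⊆b) (c , c∈C , c-indep , _)
                     (w , w∈W , w-indep , _) C⊆A∩B W⊆A+B = do
    EA ← extend {Q = A} c a c-indep¬¬ a∈A
    EB ← extend {Q = B} c b c-indep¬¬ b∈B
    kA+dC≤dA ← steinitz a (new EA ++ c) (indep EA) (++⁺ (Span a) (A⊆span ∘ new∈ EA) (A⊆span ∘ c∈A))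
    kB+dC≤dB ← steinitz b (new EB ++ c) (indep EB) (++⁺ (Span b) (B⊆span ∘ new∈ EB) (B⊆span ∘ c∈B))
    dW≤k ← steinitz (new EB ++ (new EA ++ c)) w (LinIndep⇒LinIndep¬¬ w-indep)
      (SumSp-Span-++ (new EB) (new EA) c ∘ SumSp-mono (Span-mono (spans EA) ∘ A⊆span)
                                                      (Span-mono (spans EB) ∘ B⊆span) ∘ W⊆A+B ∘ w∈W)
    return (inclusion-exclusion-≤ kA+dC≤dA kB+dC≤dB dW≤k)
    where
    c-indep¬¬ : LinIndep¬¬ c
    c-indep¬¬ = LinIndep⇒LinIndep¬¬ c-indep
    c∈A : All A c
    c∈A = proj₁ ∘ C⊆A∩B ∘ c∈C
    c∈B : All B c
    c∈B = proj₂ ∘ C⊆A∩B ∘ c∈C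
    A⊆span : A ⊆ Span a
    A⊆span = LinComb⇒Span ∘ A⊆a
    B⊆span : B ⊆ Span b
    B⊆span = LinComb⇒Span ∘ B⊆b

  dim+dim≤dim-sum+dim-inter : ∀ {dA dB dC dW} {A : Pred Carrier q} {B : Pred Carrier r} →
    IsSubspace L F A → IsSubspace L F B →
    HasDim L F A dA → HasDim L F B dB → HasDim L F (IntSp L A B) dC → HasDim L F (SumSp L A B) dW →
    ¬ ¬ dA ℕ.+ dB ℕ.≤ dW ℕ.+ dC
  dim+dim≤dim-sum+dim-inter {A = A} {B} A-sub B-sub (a , a∈A , a-indep , _) (b , b∈B , b-indep , _)
                            (c , c∈A∩B , c-indep , A∩B⊆c) (w , _ , _ , A+B⊆w) = do
    EA ← extend {Q = A} c a c-indep¬¬ a∈A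
    EB ← extend {Q = B} c b c-indep¬¬ b∈B
    dA≤kA+dC ← steinitz (new EA ++ c) a (LinIndep⇒LinIndep¬¬ a-indep) (spans EA)
    dB≤kB+dC ← steinitz (new EB ++ c) b (LinIndep⇒LinIndep¬¬ b-indep) (spans EB)
    k≤dW ← steinitz w (new EB ++ (new EA ++ c))
      (LinIndep¬¬-++-∩ c A-sub B-sub (LinComb⇒Span ∘ A∩B⊆c) (new∈ EB) (++⁺ A (new∈ EA) c∈A) (indep EB) (indep EA))
      (LinComb⇒Span ∘ A+B⊆w ∘ ∈A+B (new∈ EB) (new∈ EA))
    return (inclusion-exclusion-≥ dA≤kA+dC dB≤kB+dC k≤dW)
    where
    c-indep¬¬ : LinIndep¬¬ c
    c-indep¬¬ = LinIndep⇒LinIndep¬¬ c-indep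
    c∈A : All A c
    c∈A = proj₁ ∘ c∈A∩B
    ∈A+B : ∀ {ks kt} {s : Vector Carrier ks} {t : Vector Carrier kt} →
           All B s → All A t → All (SumSp L A B) (s ++ (t ++ c))
    ∈A+B s∈B t∈A = ++⁺ (SumSp L A B) (SumSp-inr A-sub ∘ s∈B)
                                     (++⁺ (SumSp L A B) (SumSp-inl B-sub ∘ t∈A) (SumSp-inl B-sub ∘ c∈A))

  module _ {X : Pred Carrier q} {Y : Pred Carrier q′} {S : Pred Carrier r} where

    ProdSpan-IntSp⊆ : ProdSpan L F (IntSp L X Y) S ⊆ IntSp L (ProdSpan L F X S) (ProdSpan L F Y S)
    ProdSpan-IntSp⊆ (n , x , s , x∈X∩Y , s∈S , z∈) =
      (n , x , s , proj₁ ∘ x∈X∩Y , s∈S , z∈) , (n , x , s , proj₂ ∘ x∈X∩Y , s∈S , z∈)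

    ProdSpan-SumSp⊆ : ProdSpan L F (SumSp L X Y) S ⊆ SumSp L (ProdSpan L F X S) (ProdSpan L F Y S)
    ProdSpan-SumSp⊆ {z} (n , x , s , x∈X+Y , s∈S , z∈) =
      γ · xX*s , γ · xY*s , (n , xX , s , xX∈X , s∈S , Span⇒LinComb (γ , γ∈F , refl))
                          , (n , xY , s , xY∈Y , s∈S , Span⇒LinComb (γ , γ∈F , refl)) , z≈
      where
      xX xY xX*s xY*s : Vector Carrier n
      xX i = proj₁ (x∈X+Y i)
      xY i = proj₁ (proj₂ (x∈X+Y i))
      xX*s i = xX i * s i
      xY*s i = xY i * s i
      xX∈X : All X xX
      xX∈X i = proj₁ (proj₂ (proj₂ (x∈X+Y i)))
      xY∈Y : All Y xY
      xY∈Y i = proj₁ (proj₂ (proj₂ (proj₂ (x∈X+Y i))))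
      x≈ : ∀ i → x i ≈ xX i + xY i
      x≈ i = proj₂ (proj₂ (proj₂ (proj₂ (x∈X+Y i))))
      γ : Vector Carrier n
      γ = proj₁ z∈
      γ∈F : All F γ
      γ∈F = proj₁ (proj₂ z∈)
      z≈ : z ≈ γ · xX*s + γ · xY*s
      z≈ = begin
        z                                  ≈⟨ proj₂ (proj₂ (LinComb⇒Span z∈)) ⟩
        γ · (λ i → x i * s i)              ≈⟨ ·-congʳ (λ i → trans (*-congʳ (x≈ i)) (distribʳ (s i) (xX i) (xY i))) ⟩
        γ · (λ i → xX*s i + xY*s i)        ≈⟨ ·-distribˡ-+ γ xX*s xY*s ⟩
        γ · xX*s + γ · xY*s                ∎

open import Data.Integer using (+_; _+_; _-_; _≤_; _≤?_; +≤+)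

sum-of-differences-≤ : ∀ {a b c d e f g h} → a ℕ.+ b ℕ.≤ c ℕ.+ d → e ℕ.+ f ℕ.≤ g ℕ.+ h →
                       (+ a - + g) + (+ b - + h) ≤ (+ c - + e) + (+ d - + f)
sum-of-differences-≤ {a} {b} {c} {d} {e} {f} {g} {h} ab≤cd ef≤gh = begin
  (+ a - + g) + (+ b - + h)       ≡⟨ regroup (+ a) (+ b) (+ g) (+ h) ⟩
  (+ a + + b) - (+ g + + h)       ≡⟨ ≡.cong₂ _-_ (ℤ.pos-+ a b) (ℤ.pos-+ g h) ⟨
  + (a ℕ.+ b) - + (g ℕ.+ h)           ≤⟨ ℤ.+-mono-≤ (+≤+ ab≤cd) (ℤ.neg-mono-≤ (+≤+ ef≤gh)) ⟩
  + (c ℕ.+ d) - + (e ℕ.+ f)           ≡⟨ ≡.cong₂ _-_ (ℤ.pos-+ c d) (ℤ.pos-+ e f) ⟩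
  (+ c + + d) - (+ e + + f)       ≡⟨ regroup (+ c) (+ d) (+ e) (+ f) ⟨
  (+ c - + e) + (+ d - + f)       ∎
  where
  open ℤ.≤-Reasoning
  regroup : ∀ x y z w → (x - z) + (y - w) ≡ (x + y) - (z + w)
  regroup = ℤ-Solver.solve-∀

proposition3p1 : {c ℓ p : Level} (L : Field c ℓ) (F : Pred (Field.Carrier L) p) →
    IsSubfield L F →
    (S X Y : Pred (Field.Carrier L) p) →
    IsSubspace L F S → IsSubspace L F X → IsSubspace L F Y →
    (s dX dY dXS dYS dXY dXYS dI dIS : ℕ) →
    HasDim L F S s →
    HasDim L F X dX → HasDim L F Y dY →
    HasDim L F (ProdSpan L F X S) dXS → HasDim L F (ProdSpan L F Y S) dYS →
    HasDim L F (SumSp L X Y) dXY → HasDim L F (ProdSpan L F (SumSp L X Y) S) dXYS →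
    HasDim L F (IntSp L X Y) dI → HasDim L F (ProdSpan L F (IntSp L X Y) S) dIS →
    ((+ dXYS - + dXY) + (+ dIS - + dI)) ≤ ((+ dXS - + dX) + (+ dYS - + dY))
proposition3p1 L F isF S X Y _ X-sub Y-sub _ dX dY dXS dYS dXY dXYS dI dIS _ hX hY hXS hYS hXY hXYS hI hIS =
  decidable-stable (_ ≤? _) (do
    grassmann ← dim+dim≤dim-sum+dim-inter L F isF X-sub Y-sub hX hY hI hXY
    products  ← dim-sum+dim-inter≤ L F isF hXS hYS hIS hXYS
                  (ProdSpan-IntSp⊆ L F isF {X = X} {Y} {S}) (ProdSpan-SumSp⊆ L F isF {X = X} {Y} {S})
    return (sum-of-differences-≤ {e = dX} {dY} {dXY} {dI} products grassmann))
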